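{- Let $H$ be a Hadamard matrix of order $n$ such that for every three distinct rows $i,j,k$ of $H$ there exists a row $\ell\notin\{i,j,k\}$ with $T_{ijk\ell}<n/24$. Then $n$ is a power of $2$.
   Context: A Hadamard matrix of order $n$ is an $n\times n$ matrix $H=(h_{uv})$ with entries in $\{ -1,1\}$ such that $HH^\top=nI$. For four distinct rows $i,j,k,\ell$ of $H$, put $P_{ijk\ell}=\left|\sum_{r=1}^n h_{ir}h_{jr}h_{kr}h_{\ell r}\right|$; the type of the quadruple $\{i,j,k,\ell\}$ is $T_{ijk\ell}=\frac{n-P_{ijk\ell}}{8}$. -}

module Defs where

open import Data.Nat using (ℕ; zero; suc; _^_)
open import Data.Product using (∃)
open import Data.Fin using (Fin; zero; suc)
open import Data.Integer as ℤ using (ℤ; +_; -[1+_]; ∣_∣)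
open import Data.Sum using (_⊎_)
open import Relation.Binary.PropositionalEquality using (_≡_; _≢_)
open import Data.Rational as ℚ using (ℚ)

Σℤ : (n : ℕ) → (Fin n → ℤ) → ℤ
Σℤ zero    f = + 0
Σℤ (suc n) f = f zero ℤ.+ Σℤ n (λ r → f (suc r))

δ : {n : ℕ} → Fin n → Fin n → ℤ
δ zero    zero    = + 1
δ zero    (suc _) = + 0
δ (suc _) zero    = + 0
δ (suc i) (suc j) = δ i j

Matrix : ℕ → Set
Matrix n = Fin n → Fin n → ℤ

record IsHadamard (n : ℕ) (H : Matrix n) : Set where
  field
    entries : ∀ u v → (H u v ≡ + 1) ⊎ (H u v ≡ ℤ.- (+ 1))
    orthogonal : ∀ i j → Σℤ n (λ r → H i r ℤ.* H j r) ≡ (+ n) ℤ.* δ i j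

P : {n : ℕ} → Matrix n → Fin n → Fin n → Fin n → Fin n → ℕ
P {n} H i j k l = ∣ Σℤ n (λ r → H i r ℤ.* H j r ℤ.* H k r ℤ.* H l r) ∣

T : {n : ℕ} → Matrix n → Fin n → Fin n → Fin n → Fin n → ℚ
T {n} H i j k l = ((+ n) ℤ.- (+ P H i j k l)) ℚ./ 8

IsPowerOf2 : ℕ → Set
IsPowerOf2 n = ∃ λ (e : ℕ) → n ≡ 2 ^ e

-- For ±1 vectors of length n, dist u w = n - |⟨u,w⟩| is a pseudometric, invariant under multiplying both
-- arguments entrywise by a ±1 vector, and distinct rows of a Hadamard matrix are at distance exactly n. The
-- hypothesis T < n/24 says that every product hᵢ ⊙ hⱼ ⊙ hₖ of three distinct rows is within n/3 of some row, and
-- by the triangle inequality that row is unique. Setting x · y to be the row nearest h₀ ⊙ hₓ ⊙ h_y turns the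
-- row indices into a group in which every element is its own inverse; such a group has order 2^e, since a
-- subgroup S missing some g doubles to S ∪ gS.

module Submission where

module FiniteBooleanGroup where
  open import Defs using (IsPowerOf2)
  open import Data.Bool.Base using (Bool; true; false; T; _∨_)
  open import Data.Bool.Properties using (T-∨)
  open import Data.Empty using (⊥-elim)
  open import Data.Fin.Base using (Fin; zero; suc)
  open import Data.Fin.Properties using (any?)
  import Data.Fin.Permutation as Perm
  open import Data.Nat.Base using (ℕ; zero; suc; _+_; _^_; _≤_; z≤n; s≤s)
  open import Data.Nat.Properties
    using (+-0-commutativeMonoid; ≤-trans; ≤-antisym; n≤1+n; n<1+n; m≤n+m; ^-monoʳ-<; +-identityʳ; +-suc; +-monoˡ-≤)
  open import Data.Sum.Base using (inj₁; inj₂)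
  open import Data.Product using (∃-syntax; _×_; _,_)
  open import Data.Unit.Base using (tt)
  open import Function.Base using (_∘_)
  open import Function.Bundles using (Equivalence)
  open import Relation.Binary.PropositionalEquality
  open import Relation.Nullary.Decidable using (T?; ¬?; decidable-stable; yes; no)
  open import Relation.Nullary.Negation using (¬_)
  open import Algebra.Properties.CommutativeMonoid.Sum +-0-commutativeMonoid
    using (sum; sum-cong-≗; ∑-distrib-+; sum-permute; sum-replicate-zero)

  boolToℕ : Bool → ℕ
  boolToℕ true  = 1
  boolToℕ false = 0

  size : ∀ {n} → (Fin n → Bool) → ℕ
  size S = sum (boolToℕ ∘ S)

  size-≤ : ∀ {n} (S : Fin n → Bool) → size S ≤ n
  size-≤ {zero}  S = z≤n
  size-≤ {suc n} S with S zero
  ... | true  = s≤s (size-≤ (S ∘ suc))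
  ... | false = ≤-trans (size-≤ (S ∘ suc)) (n≤1+n n)

  size-full : ∀ {n} (S : Fin n → Bool) → (∀ x → T (S x)) → size S ≡ n
  size-full {zero}  S full = refl
  size-full {suc n} S full with S zero | full zero
  ... | true | _ = cong suc (size-full (S ∘ suc) (full ∘ suc))

  size-∪ : ∀ {n} (S S′ : Fin n → Bool) → (∀ x → ¬ (T (S x) × T (S′ x))) →
           size (λ x → S x ∨ S′ x) ≡ size S + size S′
  size-∪ S S′ disjoint =
    trans (sum-cong-≗ λ x → boolToℕ-∨ (S x) (S′ x) (disjoint x)) (∑-distrib-+ (boolToℕ ∘ S) (boolToℕ ∘ S′))
    where
    boolToℕ-∨ : ∀ a b → ¬ (T a × T b) → boolToℕ (a ∨ b) ≡ boolToℕ a + boolToℕ b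
    boolToℕ-∨ true  true  both = ⊥-elim (both (tt , tt))
    boolToℕ-∨ true  false _    = refl
    boolToℕ-∨ false b     _    = refl

  module Order {m : ℕ} (_·_ : Fin (suc m) → Fin (suc m) → Fin (suc m))
    (·-identityˡ : ∀ x → zero · x ≡ x) (·-self : ∀ x → x · x ≡ zero)
    (·-comm : ∀ x y → x · y ≡ y · x) (·-assoc : ∀ x y z → (x · y) · z ≡ x · (y · z)) where

    private
      N = suc m

    ·-identityʳ : ∀ x → x · zero ≡ x
    ·-identityʳ x = trans (·-comm x zero) (·-identityˡ x)

    ·-cancelˡ : ∀ g x → g · (g · x) ≡ x
    ·-cancelˡ g x = begin
      g · (g · x) ≡⟨ ·-assoc g g x ⟨
      (g · g) · x ≡⟨ cong (_· x) (·-self g) ⟩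
      zero · x    ≡⟨ ·-identityˡ x ⟩
      x           ∎
      where open ≡-Reasoning

    ·-swap : ∀ x g y → x · (g · y) ≡ g · (x · y)
    ·-swap x g y = begin
      x · (g · y) ≡⟨ ·-assoc x g y ⟨
      (x · g) · y ≡⟨ cong (_· y) (·-comm x g) ⟩
      (g · x) · y ≡⟨ ·-assoc g x y ⟩
      g · (x · y) ∎
      where open ≡-Reasoning

    size-translate : ∀ g (S : Fin N → Bool) → size (S ∘ (g ·_)) ≡ size S
    size-translate g S =
      sym (sum-permute (boolToℕ ∘ S) (Perm.permutation (g ·_) (g ·_) (·-cancelˡ g) (·-cancelˡ g)))

    IsClosed : (Fin N → Bool) → Set
    IsClosed S = ∀ {x y} → T (S x) → T (S y) → T (S (x · y))

    closed-double : ∀ {e} (S : Fin N → Bool) → IsClosed S → size S ≡ 2 ^ e → ∀ g → ¬ T (S g) →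
                    ∃[ S′ ] IsClosed S′ × size S′ ≡ 2 ^ suc e
    closed-double {e} S closed size≡ g g∉S = S∪gS , closed′ , size′≡
      where
      S∪gS : Fin N → Bool
      S∪gS x = S x ∨ S (g · x)

      member : ∀ {x y} → x ≡ y → T (S x) → T (S y)
      member x≡y = subst (T ∘ S) x≡y

      disjoint : ∀ x → ¬ (T (S x) × T (S (g · x)))
      disjoint x (x∈S , gx∈S) =
        g∉S (member (trans (·-swap x g x) (trans (cong (g ·_) (·-self x)) (·-identityʳ g))) (closed x∈S gx∈S))

      size′≡ : size S∪gS ≡ 2 ^ suc e
      size′≡ = begin
        size S∪gS                        ≡⟨ size-∪ S (S ∘ (g ·_)) disjoint ⟩
        size S + size (S ∘ (g ·_))       ≡⟨ cong (size S +_) (size-translate g S) ⟩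
        size S + size S                  ≡⟨ cong₂ _+_ size≡ (trans size≡ (sym (+-identityʳ _))) ⟩
        2 ^ suc e                        ∎
        where open ≡-Reasoning

      closed′ : IsClosed S∪gS
      closed′ {x} {y} x∈ y∈ with Equivalence.to T-∨ x∈ | Equivalence.to T-∨ y∈
      ... | inj₁ x∈S  | inj₁ y∈S  = Equivalence.from T-∨ (inj₁ (closed x∈S y∈S))
      ... | inj₁ x∈S  | inj₂ gy∈S = Equivalence.from T-∨ (inj₂ (member (·-swap x g y) (closed x∈S gy∈S)))
      ... | inj₂ gx∈S | inj₁ y∈S  = Equivalence.from T-∨ (inj₂ (member (·-assoc g x y) (closed gx∈S y∈S)))
      ... | inj₂ gx∈S | inj₂ gy∈S = Equivalence.from T-∨ (inj₁ (member gxgy≡xy (closed gx∈S gy∈S)))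
        where
        gxgy≡xy : (g · x) · (g · y) ≡ x · y
        gxgy≡xy = trans (·-assoc g x (g · y)) (trans (cong (g ·_) (·-swap x g y)) (·-cancelˡ g (x · y)))

    isPowerOf2-by-doubling : ∀ k e (S : Fin N → Bool) → IsClosed S → size S ≡ 2 ^ e → N ≤ 2 ^ e + k → IsPowerOf2 N
    isPowerOf2-by-doubling zero e S _ size≡ N≤ =
      e , ≤-antisym (subst (N ≤_) (+-identityʳ _) N≤) (subst (_≤ N) size≡ (size-≤ S))
    isPowerOf2-by-doubling (suc k) e S closed size≡ N≤ with any? (λ x → ¬? (T? (S x)))
    ... | no S-full = e , trans (sym (size-full S λ x → decidable-stable (T? (S x)) λ x∉S → S-full (x , x∉S))) size≡
    ... | yes (g , g∉S) with closed-double {e} S closed size≡ g g∉S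
    ...   | S′ , closed′ , size′≡ = isPowerOf2-by-doubling k (suc e) S′ closed′ size′≡ (≤-trans N≤ bound)
      where
      bound : 2 ^ e + suc k ≤ 2 ^ suc e + k
      bound = subst (_≤ 2 ^ suc e + k) (sym (+-suc (2 ^ e) k))
                (+-monoˡ-≤ k (^-monoʳ-< 2 (s≤s (s≤s z≤n)) (n<1+n e)))

    private
      singleton-zero : Fin N → Bool
      singleton-zero zero    = true
      singleton-zero (suc _) = false

      singleton-zero-closed : IsClosed singleton-zero
      singleton-zero-closed {zero} {zero} _ _ = subst (T ∘ singleton-zero) (sym (·-self zero)) tt

    order-isPowerOf2 : IsPowerOf2 N
    order-isPowerOf2 = isPowerOf2-by-doubling N 0 singleton-zero singleton-zero-closed
      (cong suc (sum-replicate-zero m)) (m≤n+m N 1)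

open import Defs
open import Data.Empty using (⊥-elim)
open import Data.Empty.Irrelevant renaming (⊥-elim to ⊥-elim-irr)
open import Data.Fin.Base using (Fin; zero; suc)
open import Data.Fin.Properties using (_≟_)
open import Data.Integer.Base using (ℤ; +_; -[1+_]; ∣_∣; _+_; _*_; -_; _-_; _≤_; _<_; -≤+; +<+)
import Data.Integer.Properties as ℤ
open import Data.Integer.Tactic.RingSolver using (solve-∀)
open import Data.Nat.Base using (ℕ; zero; suc; z≤n; s≤s; NonZero)
open import Data.Product using (Σ; ∃-syntax; _×_; _,_; proj₁; proj₂)
open import Data.Rational.Base using (_/_) renaming (_<_ to _<ℚ_)
open import Data.Rational.Properties using (toℚᵘ-mono-<; toℚᵘ-fromℚᵘ)
import Data.Rational.Unnormalised.Base as ℚᵘ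
import Data.Rational.Unnormalised.Properties as ℚᵘ
open import Data.Sum.Base using (_⊎_; inj₁; inj₂)
open import Data.Vec.Functional using (Vector; zipWith)
open import Function.Base using (_∘_)
open import Relation.Binary.PropositionalEquality
open import Relation.Nullary.Decidable using (yes; no)
open import Algebra.Properties.Semiring.Sum ℤ.+-*-semiring using (sum; sum-cong-≗; *-distribˡ-sum)
open import Algebra.Properties.CommutativeMonoid.Sum ℤ.+-0-commutativeMonoid using (∑-distrib-+)
open import Algebra.Properties.CommutativeSemigroup ℤ.*-commutativeSemigroup
  using (xy∙z≈xz∙y; xy∙z≈y∙xz; xy∙z≈yz∙x)

IsSign : ℤ → Set
IsSign a = a ≡ + 1 ⊎ a ≡ - + 1

sign-* : ∀ {a b} → IsSign a → IsSign b → IsSign (a * b)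
sign-* (inj₁ refl) (inj₁ refl) = inj₁ refl
sign-* (inj₁ refl) (inj₂ refl) = inj₂ refl
sign-* (inj₂ refl) (inj₁ refl) = inj₂ refl
sign-* (inj₂ refl) (inj₂ refl) = inj₁ refl

sign-sq : ∀ {a} → IsSign a → a * a ≡ + 1
sign-sq (inj₁ refl) = refl
sign-sq (inj₂ refl) = refl

sign-cancelˡ : ∀ {a} → IsSign a → ∀ b → a * a * b ≡ b
sign-cancelˡ {a} a± b = trans (cong (_* b) (sign-sq a±)) (ℤ.*-identityˡ b)

sign-cancelʳ : ∀ {b} → IsSign b → ∀ a → a * b * b ≡ a
sign-cancelʳ {b} b± a = trans (ℤ.*-assoc a b b) (trans (cong (a *_) (sign-sq b±)) (ℤ.*-identityʳ a))

sign-+-≤ : ∀ {a b} → IsSign a → IsSign b → a + b ≤ a * b + + 1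
sign-+-≤ (inj₁ refl) (inj₁ refl) = ℤ.≤-refl
sign-+-≤ (inj₁ refl) (inj₂ refl) = ℤ.≤-refl
sign-+-≤ (inj₂ refl) (inj₁ refl) = ℤ.≤-refl
sign-+-≤ (inj₂ refl) (inj₂ refl) = -≤+

i≤+∣i∣ : ∀ i → i ≤ + ∣ i ∣
i≤+∣i∣ (+ _)    = ℤ.≤-refl
i≤+∣i∣ -[1+ _ ] = -≤+

sign-*-≤-∣∣ : ∀ {s} → IsSign s → ∀ i → s * i ≤ + ∣ i ∣
sign-*-≤-∣∣ (inj₁ refl) i = subst (_≤ + ∣ i ∣) (sym (ℤ.*-identityˡ i)) (i≤+∣i∣ i)
sign-*-≤-∣∣ (inj₂ refl) i = subst₂ _≤_ (sym (ℤ.-1*i≡-i i)) (cong +_ (ℤ.∣-i∣≡∣i∣ i)) (i≤+∣i∣ (- i))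

∣∣-by-sign : ∀ i → ∃[ s ] IsSign s × s * i ≡ + ∣ i ∣
∣∣-by-sign i with ℤ.+∣i∣≡i⊎+∣i∣≡-i i
... | inj₁ eq = + 1 , inj₁ refl , trans (ℤ.*-identityˡ i) (sym eq)
... | inj₂ eq = - + 1 , inj₂ refl , trans (ℤ.-1*i≡-i i) (sym eq)

x+y≤z+n⇒n-z≤[n-x]+[n-y] : ∀ {x y z n} → x + y ≤ z + n → n - z ≤ (n - x) + (n - y)
x+y≤z+n⇒n-z≤[n-x]+[n-y] {x} {y} {z} {n} x+y≤z+n = subst₂ _≤_ (rearrange n z) (rearrange′ n x y)
  (ℤ.+-monoʳ-≤ (n + n) (ℤ.neg-mono-≤ x+y≤z+n))
  where
  rearrange : ∀ n z → n + n - (z + n) ≡ n - z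
  rearrange = solve-∀
  rearrange′ : ∀ n x y → n + n - (x + y) ≡ (n - x) + (n - y)
  rearrange′ = solve-∀

sum-mono-≤ : ∀ {n} {f g : Vector ℤ n} → (∀ r → f r ≤ g r) → sum f ≤ sum g
sum-mono-≤ {zero}  f≤g = ℤ.≤-refl
sum-mono-≤ {suc n} f≤g = ℤ.+-mono-≤ (f≤g zero) (sum-mono-≤ (f≤g ∘ suc))

sum-ones : ∀ n → sum {n} (λ _ → + 1) ≡ + n
sum-ones zero    = refl
sum-ones (suc n) = cong (_+_ (+ 1)) (sum-ones n)

module _ {n : ℕ} where

  SignVector : Vector ℤ n → Set
  SignVector u = ∀ r → IsSign (u r)

  infixl 7 _⊙_
  _⊙_ : Vector ℤ n → Vector ℤ n → Vector ℤ n
  _⊙_ = zipWith _*_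

  ⟨_,_⟩ : Vector ℤ n → Vector ℤ n → ℤ
  ⟨ u , w ⟩ = sum (u ⊙ w)

  -- For sign vectors this is twice the Hamming distance from u to the nearer of w and -w, and
  -- T H i j k l = dist (H i ⊙ H j ⊙ H k) (H l) / 8.
  dist : Vector ℤ n → Vector ℤ n → ℤ
  dist u w = + n - + ∣ ⟨ u , w ⟩ ∣

  ⊙-sign : ∀ {u w} → SignVector u → SignVector w → SignVector (u ⊙ w)
  ⊙-sign u± w± r = sign-* (u± r) (w± r)

  ⟨⟩-comm : ∀ u w → ⟨ u , w ⟩ ≡ ⟨ w , u ⟩
  ⟨⟩-comm u w = sum-cong-≗ λ r → ℤ.*-comm (u r) (w r)

  ⟨⟩-self : ∀ {u} → SignVector u → ⟨ u , u ⟩ ≡ + n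
  ⟨⟩-self u± = trans (sum-cong-≗ (sign-sq ∘ u±)) (sum-ones n)

  ⟨⟩-⊙ʳ : ∀ {c} → SignVector c → ∀ u w → ⟨ u ⊙ c , w ⊙ c ⟩ ≡ ⟨ u , w ⟩
  ⟨⟩-⊙ʳ {c} c± u w = sum-cong-≗ λ r → trans (rearrange (u r) (w r) (c r)) (sign-cancelʳ (c± r) (u r * w r))
    where
    rearrange : ∀ a b c → a * c * (b * c) ≡ a * b * c * c
    rearrange = solve-∀

  dist-comm : ∀ u w → dist u w ≡ dist w u
  dist-comm u w = cong (λ i → + n - + ∣ i ∣) (⟨⟩-comm u w)

  dist-cong : ∀ {u u′ w w′} → u ≗ u′ → w ≗ w′ → dist u w ≡ dist u′ w′
  dist-cong u≗u′ w≗w′ = cong (λ i → + n - + ∣ i ∣) (sum-cong-≗ λ r → cong₂ _*_ (u≗u′ r) (w≗w′ r))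

  dist-self : ∀ {u} → SignVector u → dist u u ≡ + 0
  dist-self u± = trans (cong (λ i → + n - + ∣ i ∣) (⟨⟩-self u±)) (ℤ.+-inverseʳ (+ n))

  dist-⊙ʳ : ∀ {c} → SignVector c → ∀ u w → dist (u ⊙ c) (w ⊙ c) ≡ dist u w
  dist-⊙ʳ c± u w = cong (λ i → + n - + ∣ i ∣) (⟨⟩-⊙ʳ c± u w)

  -- With s, t the signs of ⟨a,b⟩ and ⟨b,c⟩, sum x + y ≤ x y + 1 over x = s aᵣ bᵣ, y = t bᵣ cᵣ,
  -- for which x y = s t aᵣ cᵣ.
  ∣⟨⟩∣-triangle : ∀ {a b c} → SignVector a → SignVector b → SignVector c →
                  + ∣ ⟨ a , b ⟩ ∣ + + ∣ ⟨ b , c ⟩ ∣ ≤ + ∣ ⟨ a , c ⟩ ∣ + + n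
  ∣⟨⟩∣-triangle {a} {b} {c} a± b± c± with ∣∣-by-sign ⟨ a , b ⟩ | ∣∣-by-sign ⟨ b , c ⟩
  ... | s , s± , s⟨a,b⟩ | t , t± , t⟨b,c⟩ = begin
    + ∣ ⟨ a , b ⟩ ∣ + + ∣ ⟨ b , c ⟩ ∣
      ≡⟨ cong₂ _+_ s⟨a,b⟩ t⟨b,c⟩ ⟨
    s * ⟨ a , b ⟩ + t * ⟨ b , c ⟩
      ≡⟨ cong₂ _+_ (*-distribˡ-sum s (a ⊙ b)) (*-distribˡ-sum t (b ⊙ c)) ⟩
    sum (λ r → s * (a r * b r)) + sum (λ r → t * (b r * c r))
      ≡⟨ ∑-distrib-+ (λ r → s * (a r * b r)) (λ r → t * (b r * c r)) ⟨
    sum (λ r → s * (a r * b r) + t * (b r * c r))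
      ≤⟨ sum-mono-≤ pointwise ⟩
    sum (λ r → s * t * (a r * c r) + + 1)
      ≡⟨ ∑-distrib-+ (λ r → s * t * (a r * c r)) (λ (_ : Fin n) → + 1) ⟩
    sum (λ r → s * t * (a r * c r)) + sum {n} (λ _ → + 1)
      ≡⟨ cong₂ _+_ (sym (*-distribˡ-sum (s * t) (a ⊙ c))) (sum-ones n) ⟩
    s * t * ⟨ a , c ⟩ + + n
      ≤⟨ ℤ.+-monoˡ-≤ (+ n) (sign-*-≤-∣∣ (sign-* s± t±) ⟨ a , c ⟩) ⟩
    + ∣ ⟨ a , c ⟩ ∣ + + n ∎
    where
    open ℤ.≤-Reasoning
    pointwise : ∀ r → s * (a r * b r) + t * (b r * c r) ≤ s * t * (a r * c r) + + 1
    pointwise r = subst (λ x → s * (a r * b r) + t * (b r * c r) ≤ x + + 1)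
      (trans (rearrange s t (a r) (b r) (c r)) (sign-cancelʳ (b± r) (s * t * (a r * c r))))
      (sign-+-≤ (sign-* s± (sign-* (a± r) (b± r))) (sign-* t± (sign-* (b± r) (c± r))))
      where
      rearrange : ∀ s t a b c → s * (a * b) * (t * (b * c)) ≡ s * t * (a * c) * b * b
      rearrange = solve-∀

  dist-triangle : ∀ {a b c} → SignVector a → SignVector b → SignVector c → dist a c ≤ dist a b + dist b c
  dist-triangle {a} {b} {c} a± b± c± =
    x+y≤z+n⇒n-z≤[n-x]+[n-y] {+ ∣ ⟨ a , b ⟩ ∣} {+ ∣ ⟨ b , c ⟩ ∣} {+ ∣ ⟨ a , c ⟩ ∣} {+ n}
      (∣⟨⟩∣-triangle a± b± c±)

  Near : Vector ℤ n → Vector ℤ n → Set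
  Near u w = dist u w * + 3 < + n

  near-comm : ∀ u w → Near u w → Near w u
  near-comm u w = subst (λ d → d * + 3 < + n) (dist-comm u w)

  near-chain : ∀ {a x y b} → SignVector a → SignVector x → SignVector y → SignVector b →
               Near a x → Near x y → Near y b → dist a b < + n
  near-chain {a} {x} {y} {b} a± x± y± b± a~x x~y y~b = ℤ.*-cancelʳ-<-nonNeg (+ 3) (begin-strict
    dist a b * + 3
      ≤⟨ ℤ.*-monoʳ-≤-nonNeg (+ 3) (ℤ.≤-trans (dist-triangle a± x± b±)
                                    (ℤ.+-monoʳ-≤ (dist a x) (dist-triangle x± y± b±))) ⟩
    (dist a x + (dist x y + dist y b)) * + 3
      ≡⟨ distribute (dist a x) (dist x y) (dist y b) ⟩
    dist a x * + 3 + (dist x y * + 3 + dist y b * + 3)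
      <⟨ ℤ.+-mono-< a~x (ℤ.+-mono-< x~y y~b) ⟩
    + n + (+ n + + n)
      ≡⟨ thrice (+ n) ⟩
    + n * + 3 ∎)
    where
    open ℤ.≤-Reasoning
    distribute : ∀ p q r → (p + (q + r)) * + 3 ≡ p * + 3 + (q * + 3 + r * + 3)
    distribute = solve-∀
    thrice : ∀ p → p + (p + p) ≡ p * + 3
    thrice = solve-∀

Σℤ≡sum : ∀ n (f : Vector ℤ n) → Σℤ n f ≡ sum f
Σℤ≡sum zero    f = refl
Σℤ≡sum (suc n) f = cong (_+_ (f zero)) (Σℤ≡sum n (f ∘ suc))

δ-≢ : ∀ {n} {i j : Fin n} → i ≢ j → δ i j ≡ + 0
δ-≢ {i = zero}  {zero}  i≢j = ⊥-elim (i≢j refl)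
δ-≢ {i = zero}  {suc j} i≢j = refl
δ-≢ {i = suc i} {zero}  i≢j = refl
δ-≢ {i = suc i} {suc j} i≢j = δ-≢ (i≢j ∘ cong suc)

/8<n/24⇒*3<n : ∀ x n → x / 8 <ℚ + n / 24 → x * + 3 < + n
/8<n/24⇒*3<n x n x/8<n/24 with ℚᵘ.<-respʳ-≃ (toℚᵘ-fromℚᵘ (ℚᵘ.mkℚᵘ (+ n) 23))
                                (ℚᵘ.<-respˡ-≃ (toℚᵘ-fromℚᵘ (ℚᵘ.mkℚᵘ x 7)) (toℚᵘ-mono-< x/8<n/24))
... | ℚᵘ.*<* x*24<n*8 = ℤ.*-cancelʳ-<-nonNeg (+ 8) (subst (_< + n * + 8) (sym (ℤ.*-assoc x (+ 3) (+ 8))) x*24<n*8)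

module RowGroup {m : ℕ} (H : Matrix (suc m)) (hadamard : IsHadamard (suc m) H)
  (near : ∀ i j k → i ≢ j → i ≢ k → j ≢ k → ∃[ l ] Near (H i ⊙ H j ⊙ H k) (H l)) where

  open IsHadamard hadamard

  private
    N = suc m

  row-sign : ∀ i → SignVector (H i)
  row-sign = entries

  triple : Fin N → Fin N → Fin N → Vector ℤ N
  triple i j k = H i ⊙ H j ⊙ H k

  triple-sign : ∀ i j k → SignVector (triple i j k)
  triple-sign i j k = ⊙-sign (⊙-sign (row-sign i) (row-sign j)) (row-sign k)

  dist-rows : ∀ {i j} → i ≢ j → dist (H i) (H j) ≡ + N
  dist-rows {i} {j} i≢j = begin
    + N - + ∣ ⟨ H i , H j ⟩ ∣        ≡⟨ cong (λ s → + N - + ∣ s ∣) (Σℤ≡sum N (H i ⊙ H j)) ⟨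
    + N - + ∣ Σℤ N (H i ⊙ H j) ∣     ≡⟨ cong (λ s → + N - + ∣ s ∣) (orthogonal i j) ⟩
    + N - + ∣ + N * δ i j ∣          ≡⟨ cong (λ s → + N - + ∣ + N * s ∣) (δ-≢ i≢j) ⟩
    + N - + ∣ + N * + 0 ∣            ≡⟨ cong (λ s → + N - + ∣ s ∣) (ℤ.*-zeroʳ (+ N)) ⟩
    + N - + 0                        ≡⟨ ℤ.+-identityʳ (+ N) ⟩
    + N                              ∎
    where open ≡-Reasoning

  dist-rows<N⇒≡ : ∀ {i j} → dist (H i) (H j) < + N → i ≡ j
  dist-rows<N⇒≡ {i} {j} d<N with i ≟ j
  ... | yes i≡j = i≡j
  ... | no  i≢j = ⊥-elim (ℤ.<-irrefl (dist-rows i≢j) d<N)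

  ≗⇒Near : ∀ {u v} → SignVector u → u ≗ v → Near u v
  ≗⇒Near {u} {v} u± u≗v = subst (λ d → d * + 3 < + N)
    (sym (trans (dist-cong {u = u} {u′ = u} {w = v} {w′ = u} (λ _ → refl) (sym ∘ u≗v)) (dist-self u±)))
    (+<+ (s≤s z≤n))

  near-row-unique : ∀ {u u′ i j} → SignVector u → SignVector u′ → u ≗ u′ →
                    Near u (H i) → Near u′ (H j) → i ≡ j
  near-row-unique {u} {u′} {i} {j} u± u′± u≗u′ u~i u′~j = dist-rows<N⇒≡
    (near-chain (row-sign i) u± u′± (row-sign j)
      (near-comm u (H i) u~i) (≗⇒Near u± u≗u′) u′~j)

  nearest : ∀ i j k → ∃[ l ] Near (triple i j k) (H l)
  nearest i j k with i ≟ j | i ≟ k | j ≟ k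
  ... | yes refl | _        | _        = k , ≗⇒Near (triple-sign i i k) λ r →
    sign-cancelˡ (row-sign i r) (H k r)
  ... | no _     | yes refl | _        = j , ≗⇒Near (triple-sign i j i) λ r →
    trans (xy∙z≈xz∙y (H i r) (H j r) (H i r)) (sign-cancelˡ (row-sign i r) (H j r))
  ... | no _     | no _     | yes refl = i , ≗⇒Near (triple-sign i j j) λ r →
    sign-cancelʳ (row-sign j r) (H i r)
  ... | no i≢j   | no i≢k   | no j≢k   = near i j k i≢j i≢k j≢k

  _·_ : Fin N → Fin N → Fin N
  x · y = proj₁ (nearest zero x y)

  ·-near : ∀ x y → Near (triple zero x y) (H (x · y))
  ·-near x y = proj₂ (nearest zero x y)

  ·-identityˡ : ∀ x → zero · x ≡ x
  ·-identityˡ x = near-row-unique (triple-sign zero zero x) (row-sign x)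
    (λ r → sign-cancelˡ (row-sign zero r) (H x r)) (·-near zero x) (≗⇒Near (row-sign x) λ _ → refl)

  ·-self : ∀ x → x · x ≡ zero
  ·-self x = near-row-unique (triple-sign zero x x) (row-sign zero)
    (λ r → sign-cancelʳ (row-sign x r) (H zero r)) (·-near x x) (≗⇒Near (row-sign zero) λ _ → refl)

  ·-comm : ∀ x y → x · y ≡ y · x
  ·-comm x y = near-row-unique (triple-sign zero x y) (triple-sign zero y x)
    (λ r → xy∙z≈xz∙y (H zero r) (H x r) (H y r)) (·-near x y) (·-near y x)

  -- Multiplication by the sign vector h₀ ⊙ h_q is an isometry carrying the near pair (h_{j·k}, h₀ ⊙ h_j ⊙ h_k)
  -- to (h₀ ⊙ h_{j·k} ⊙ h_q, h_j ⊙ h_k ⊙ h_q).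
  ·-·-nearest : ∀ j k q → (j · k) · q ≡ proj₁ (nearest j k q)
  ·-·-nearest j k q = dist-rows<N⇒≡ (near-chain (row-sign ((j · k) · q)) (triple-sign zero (j · k) q)
    (triple-sign j k q) (row-sign _)
    (near-comm (triple zero (j · k) q) (H ((j · k) · q)) (·-near (j · k) q)) middle (proj₂ (nearest j k q)))
    where
    c : Vector ℤ N
    c = H zero ⊙ H q

    c-sign : SignVector c
    c-sign = ⊙-sign (row-sign zero) (row-sign q)

    move-c : ∀ a → triple zero a q ≗ H a ⊙ c
    move-c a r = xy∙z≈y∙xz (H zero r) (H a r) (H q r)

    cancel-h₀ : triple j k q ≗ triple zero j k ⊙ c
    cancel-h₀ r = sym (trans (rearrange (H zero r) (H j r) (H k r) (H q r)) (sign-cancelʳ (row-sign zero r) _))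
      where
      rearrange : ∀ z a b d → z * a * b * (z * d) ≡ a * b * d * z * z
      rearrange = solve-∀

    middle : Near (triple zero (j · k) q) (triple j k q)
    middle = subst (λ d → d * + 3 < + N) (sym (begin
      dist (triple zero (j · k) q) (triple j k q)  ≡⟨ dist-cong (move-c (j · k)) cancel-h₀ ⟩
      dist (H (j · k) ⊙ c) (triple zero j k ⊙ c)  ≡⟨ dist-⊙ʳ c-sign (H (j · k)) (triple zero j k) ⟩
      dist (H (j · k)) (triple zero j k)          ≡⟨ dist-comm (H (j · k)) (triple zero j k) ⟩
      dist (triple zero j k) (H (j · k))          ∎))
      (·-near j k)
      where open ≡-Reasoning

  ·-assoc : ∀ x y w → (x · y) · w ≡ x · (y · w)
  ·-assoc x y w = begin
    (x · y) · w             ≡⟨ ·-·-nearest x y w ⟩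
    proj₁ (nearest x y w)   ≡⟨ near-row-unique (triple-sign x y w) (triple-sign y w x)
                                 (λ r → xy∙z≈yz∙x (H x r) (H y r) (H w r))
                                 (proj₂ (nearest x y w)) (proj₂ (nearest y w x)) ⟩
    proj₁ (nearest y w x)   ≡⟨ ·-·-nearest y w x ⟨
    (y · w) · x             ≡⟨ ·-comm (y · w) x ⟩
    x · (y · w)             ∎
    where open ≡-Reasoning

  order-isPowerOf2 : IsPowerOf2 N
  order-isPowerOf2 = FiniteBooleanGroup.Order.order-isPowerOf2 _·_ ·-identityˡ ·-self ·-comm ·-assoc

T<n/24⇒Near : ∀ {n} (H : Matrix n) {i j k l} → T H i j k l <ℚ + n / 24 → Near (H i ⊙ H j ⊙ H k) (H l)
T<n/24⇒Near {n} H {i} {j} {k} {l} = /8<n/24⇒*3<n (dist (H i ⊙ H j ⊙ H k) (H l)) n ∘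
  subst (_<ℚ + n / 24) (cong (λ s → (+ n - + ∣ s ∣) / 8) (Σℤ≡sum n (H i ⊙ H j ⊙ H k ⊙ H l)))

corollary3p5 : (n : ℕ) → .{{_ : NonZero n}} → (H : Matrix n) → IsHadamard n H →
    (∀ (i j k : Fin n) → i ≢ j → i ≢ k → j ≢ k →
      Σ (Fin n) (λ l → (l ≢ i × l ≢ j × l ≢ k) × (T H i j k l <ℚ (+ n) / 24))) →
    IsPowerOf2 n
corollary3p5 zero {{n≢0}} _ _ _ = ⊥-elim-irr (NonZero.nonZero n≢0)
corollary3p5 (suc m) H hadamard hyp = RowGroup.order-isPowerOf2 H hadamard near
  where
  near : ∀ i j k → i ≢ j → i ≢ k → j ≢ k → ∃[ l ] Near (H i ⊙ H j ⊙ H k) (H l)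
  near i j k i≢j i≢k j≢k with hyp i j k i≢j i≢k j≢k
  ... | l , _ , T<n/24 = l , T<n/24⇒Near H T<n/24
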